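{- Let $S$ be a set with a binary relation $R$ that is up-directed, reflexive and antisymmetric. Let $\approx$ be the equivalence on $\wp(S)$ given by $X\approx Y$ iff $X^{l}=Y^{l}$ and $X^{u}=Y^{u}$, and for an equivalence class $a$ of $\approx$ let $a_l=X^{l}$ and $a_u=X^{u}$ for any $X\in a$. Then for every class $a$ and every $X\in a$ there is $K\subseteq S$ with $X=a_l\cup K$, $K^{l}=\emptyset$ and $(a_l)^{u}\cup K^{u}=a_u$.
   Context: $Rab$ means $(a,b)\in R$; up-directed means $(\forall a,b)(\exists c)\,Rac\,\&\,Rbc$. $[x]=\{y: Ryx\}$; for $A\subseteq S$, $A^{l}=\bigcup\{[x]: [x]\subseteq A\}$ and $A^{u}=\bigcup\{[x]: [x]\cap A\neq\emptyset\}$. -}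

module Defs where

open import Level using (0ℓ)
open import Data.Product using (∃; _×_)
open import Relation.Binary using (Rel)
open import Relation.Unary using (Pred; _⊆_; _∩_; Satisfiable; _≐_)

UpDirected : {S : Set} → Rel S 0ℓ → Set
UpDirected {S} R = ∀ (a b : S) → ∃ λ c → R a c × R b c

[_]⟨_⟩ : {S : Set} → S → Rel S 0ℓ → Pred S 0ℓ
[ x ]⟨ R ⟩ = λ y → R y x

lower : {S : Set} → Rel S 0ℓ → Pred S 0ℓ → Pred S 0ℓ
lower R A = λ z → ∃ λ x → ([ x ]⟨ R ⟩ ⊆ A) × R z x

upper : {S : Set} → Rel S 0ℓ → Pred S 0ℓ → Pred S 0ℓ
upper R A = λ z → ∃ λ x → Satisfiable ([ x ]⟨ R ⟩ ∩ A) × R z x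

_≈⟨_⟩_ : {S : Set} → Pred S 0ℓ → Rel S 0ℓ → Pred S 0ℓ → Set
X ≈⟨ R ⟩ Y = (lower R X ≐ lower R Y) × (upper R X ≐ upper R Y)

module Submission where

-- Every set X splits as X = X^l ∪ (X ∖ X^l): the lower
-- approximation is contained in X, and (classically) each point of X is
-- either in X^l or not.  The residue K = X ∖ X^l has empty lower
-- approximation as soon as R is reflexive: if [x] ⊆ K then x ∈ K, yet
-- [x] ⊆ K ⊆ X puts x into X^l.  Since upper approximation commutes with
-- binary unions, the split also gives X^u = (X^l)^u ∪ K^u.  Finally, for
-- X ≈ A we may replace X^l by A^l and X^u by A^u, which is exactly the
-- theorem with a_l = A^l and a_u = A^u.

open import Defs
open import Level using (0ℓ)
open import Data.Product using (∃; _×_; _,_; proj₁; proj₂)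
open import Data.Sum using (inj₁; inj₂; [_,_])
open import Relation.Nullary using (yes; no)
open import Relation.Binary using (Rel; Reflexive; Antisymmetric)
open import Relation.Binary.PropositionalEquality using (_≡_)
open import Relation.Unary using (Pred; _⊆_; _∪_; _∖_; _≐_; ∅)
open import Relation.Unary.Properties using (≐-trans; ≐-sym)
open import Axiom.ExcludedMiddle using (ExcludedMiddle)

∪-congˡ : {S : Set} {P Q T : Pred S 0ℓ} → P ≐ Q → (P ∪ T) ≐ (Q ∪ T)
∪-congˡ (P⊆Q , Q⊆P) = [ (λ p → inj₁ (P⊆Q p)) , inj₂ ]
                    , [ (λ q → inj₁ (Q⊆P q)) , inj₂ ]

module _ {S : Set} (R : Rel S 0ℓ) where

  lower-⊆ : (X : Pred S 0ℓ) → lower R X ⊆ X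
  lower-⊆ X (x , [x]⊆X , Rzx) = [x]⊆X Rzx

  upper-mono : {X Y : Pred S 0ℓ} → X ⊆ Y → upper R X ⊆ upper R Y
  upper-mono X⊆Y (x , (y , Ryx , y∈X) , Rzx) = x , (y , Ryx , X⊆Y y∈X) , Rzx

  upper-∪ : (X Y : Pred S 0ℓ) → upper R (X ∪ Y) ≐ (upper R X ∪ upper R Y)
  upper-∪ X Y = split , [ upper-mono inj₁ , upper-mono inj₂ ]
    where
    split : upper R (X ∪ Y) ⊆ (upper R X ∪ upper R Y)
    split (x , (y , Ryx , inj₁ y∈X) , Rzx) = inj₁ (x , (y , Ryx , y∈X) , Rzx)
    split (x , (y , Ryx , inj₂ y∈Y) , Rzx) = inj₂ (x , (y , Ryx , y∈Y) , Rzx)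

  residue : Pred S 0ℓ → Pred S 0ℓ
  residue X = X ∖ lower R X

  lower-residue-empty : Reflexive R → (X : Pred S 0ℓ) → lower R (residue X) ≐ ∅
  lower-residue-empty refl-R X = empty , λ ()
    where
    empty : lower R (residue X) ⊆ ∅
    empty (x , [x]⊆K , _) =
      proj₂ ([x]⊆K refl-R) (x , (λ Ryx → proj₁ ([x]⊆K Ryx)) , refl-R)

  lower-residue-split : ExcludedMiddle 0ℓ → (X : Pred S 0ℓ) →
                        X ≐ (lower R X ∪ residue X)
  lower-residue-split em X = split , [ lower-⊆ X , proj₁ ]
    where
    split : X ⊆ (lower R X ∪ residue X)
    split {z} z∈X with em {lower R X z}
    ... | yes z∈Xˡ = inj₁ z∈Xˡ
    ... | no  z∉Xˡ = inj₂ (z∈X , z∉Xˡ)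

  upper-cong : {X Y : Pred S 0ℓ} → X ≐ Y → upper R X ≐ upper R Y
  upper-cong (X⊆Y , Y⊆X) = upper-mono X⊆Y , upper-mono Y⊆X

mainTheorem6 : ExcludedMiddle 0ℓ → {S : Set} (R : Rel S 0ℓ) →
    UpDirected R → Reflexive R → Antisymmetric _≡_ R →
    (A X : Pred S 0ℓ) → X ≈⟨ R ⟩ A →
    ∃ λ (K : Pred S 0ℓ) →
    (X ≐ (lower R A ∪ K)) × (lower R K ≐ ∅) × ((upper R (lower R A) ∪ upper R K) ≐ upper R A)
mainTheorem6 em R _ refl-R _ A X (Xˡ≐Aˡ , Xᵘ≐Aᵘ) =
  residue R X , X≐Aˡ∪K , lower-residue-empty R refl-R X , Aˡᵘ∪Kᵘ≐Aᵘ
  where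
  X≐Aˡ∪K : X ≐ (lower R A ∪ residue R X)
  X≐Aˡ∪K = ≐-trans (lower-residue-split R em X) (∪-congˡ Xˡ≐Aˡ)

  -- (A^l)^u ∪ K^u = (X^l)^u ∪ K^u = (X^l ∪ K)^u = X^u = A^u.
  Aˡᵘ∪Kᵘ≐Aᵘ : (upper R (lower R A) ∪ upper R (residue R X)) ≐ upper R A
  Aˡᵘ∪Kᵘ≐Aᵘ =
    ≐-trans (∪-congˡ (upper-cong R (≐-sym Xˡ≐Aˡ)))
    (≐-trans (≐-sym (upper-∪ R (lower R X) (residue R X)))
    (≐-trans (upper-cong R (≐-sym (lower-residue-split R em X)))
             Xᵘ≐Aᵘ))
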